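{- A permutation $\pi\in \mathbf{S}_{n+1}$ is the suffix array of a word $w\sharp$ with $w\in\{a,b\}^n$ and $a < \sharp < b$ if and only if $\{\,i\in[1,n] : \Phi(\pi)(i)>\Phi(\pi)(i+1)\,\}\subseteq\{\pi^{ -1}(n+1)-1,\pi^{ -1}(n+1)\}$.
   Context: $\mathbf{S}_m$ is the set of permutations of $[1,m]$. The suffix array of a word $u=u_1\dots u_m$ is the permutation $\pi$ with $\pi(i)=j$ iff $u_j\dots u_m$ is the $i$-th suffix of $u$ in lexicographic order (here with respect to the ordering $a<\sharp<b$). For $\pi\in\mathbf{S}_{m}$ the linking permutation is $\Phi(\pi)=\pi^{ -1}(\pi+1)$, i.e. $\Phi(\pi)(i)=\pi^{ -1}(\pi(i)+1)$ where values are taken cyclically ($m+1\equiv 1$). -}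

module Defs where

open import Data.Nat using (ℕ; zero; suc; _+_; _%_)
open import Data.Nat.DivMod using (m%n<n)
open import Data.Fin using (Fin; toℕ; fromℕ<)
open import Data.Fin.Permutation using (Permutation′; _⟨$⟩ʳ_; _⟨$⟩ˡ_)
open import Data.List using (List; []; _∷_; drop; _++_; [_])
open import Data.Vec using (Vec; toList; map)

data Letter : Set where
  a ♯ b : Letter

data _<ₗ_ : Letter → Letter → Set where
  a<♯ : a <ₗ ♯
  a<b : a <ₗ b
  ♯<b : ♯ <ₗ b

data _<Lex_ : List Letter → List Letter → Set where
  []<∷  : ∀ {y ys} → [] <Lex (y ∷ ys)
  head< : ∀ {x y xs ys} → x <ₗ y → (x ∷ xs) <Lex (y ∷ ys)
  tail< : ∀ {x xs ys} → xs <Lex ys → (x ∷ xs) <Lex (x ∷ ys)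

data AB : Set where
  a' b' : AB

embed : AB → Letter
embed a' = a
embed b' = b

w♯ : ∀ {n} → Vec AB n → List Letter
w♯ w = toList (map embed w) ++ [ ♯ ]

-- Positions and ranks are 0-indexed: Fin m stands for [1,m] shifted by one.
-- The suffix starting at (0-indexed) position j.
suffix : List Letter → ℕ → List Letter
suffix u j = drop j u

-- π is the suffix array of u (|u| = m): π(i) = j iff the suffix at
-- position j is the i-th suffix in lexicographic order, i.e. the ranked
-- suffixes are strictly increasing.
IsSuffixArray : ∀ {m} → Permutation′ m → List Letter → Set
IsSuffixArray {m} π u =
  ∀ (i j : Fin m) → toℕ i Data.Nat.< toℕ j →
    suffix u (toℕ (π ⟨$⟩ʳ i)) <Lex suffix u (toℕ (π ⟨$⟩ʳ j))
  where import Data.Nat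

csuc : ∀ {n} → Fin (suc n) → Fin (suc n)
csuc {n} x = fromℕ< (m%n<n (suc (toℕ x)) (suc n))

Φ : ∀ {n} → Permutation′ (suc n) → Fin (suc n) → Fin (suc n)
Φ π i = π ⟨$⟩ˡ csuc (π ⟨$⟩ʳ i)

-- Φ(π) sends the rank of the suffix at position j to the rank of the suffix
-- at j + 1. In the suffix array of w♯, the suffixes ranked below the suffix ♯
-- start with a and those ranked above it start with b; two suffixes with the
-- same first letter are ordered like their tails, so Φ(π) is increasing on
-- each of these two blocks of ranks, and a descent can only straddle the rank
-- of ♯. Conversely, if Φ(π) is increasing on both blocks, the word with a at
-- the positions ranked below ♯ and b at those ranked above has π as its suffix
-- array: suffixes are compared by their first letters, and when these agree,
-- by their tails, which are again ordered correctly (induction on the position).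
module Submission where

open import Defs
open import Data.Nat using (ℕ; suc; _+_; _>_)
open import Data.Fin using (Fin; toℕ; inject₁; fromℕ) renaming (suc to fsuc)
open import Data.Fin.Permutation using (Permutation′; _⟨$⟩ˡ_)
open import Data.Vec using (Vec)
open import Data.Product using (∃-syntax)
open import Data.Sum using (_⊎_)
open import Relation.Binary.PropositionalEquality using (_≡_)
open import Function.Bundles using (_⇔_)

open import Data.Nat using (zero; _≤_; _<_; z≤n; s≤s; s<s⁻¹; _%_; _∸_; _<?_; _≟_)
open import Data.Nat.Properties
open import Data.Nat.DivMod using (_mod_; m≤n⇒m%n≡m; n%n≡0)
open import Data.Fin using (fromℕ<)
open import Data.Fin.Properties
  using (toℕ-injective; toℕ-fromℕ<; toℕ-fromℕ; toℕ-inject₁; toℕ≤pred[n]; toℕ<n; ≤̄⇒inject₁<)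
open import Data.Fin.Permutation using (_⟨$⟩ʳ_; inverseˡ; inverseʳ)
open import Data.Vec using ([]; _∷_; lookup; tabulate)
open import Data.Vec.Properties using (lookup∘tabulate)
open import Data.List using (List; _∷_; [_])
open import Data.Product using (_,_)
open import Data.Sum using (inj₁; inj₂; [_,_]′)
open import Data.Empty using (⊥-elim)
open import Function using (_∘_)
open import Relation.Nullary using (¬_; yes; no)
open import Relation.Binary.Definitions using (tri<; tri≈; tri>)
open import Relation.Binary.PropositionalEquality
  using (_≢_; refl; sym; trans; cong; subst; subst₂)
open import Function.Bundles using (mk⇔)

<ₗ-asym : ∀ {x y} → x <ₗ y → ¬ y <ₗ x
<ₗ-asym a<♯ ()
<ₗ-asym a<b ()
<ₗ-asym ♯<b ()

<Lex-asym : ∀ {xs ys} → xs <Lex ys → ¬ ys <Lex xs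
<Lex-asym []<∷        ()
<Lex-asym (head< x<y) (head< y<x) = <ₗ-asym x<y y<x
<Lex-asym (head< x<x) (tail< _)   = <ₗ-asym x<x x<x
<Lex-asym (tail< _)   (head< x<x) = <ₗ-asym x<x x<x
<Lex-asym (tail< p)   (tail< q)   = <Lex-asym p q

<Lex-irrefl : ∀ {xs} → ¬ xs <Lex xs
<Lex-irrefl p = <Lex-asym p p

∷-<Lex-∷⁻ : ∀ {c xs ys} → (c ∷ xs) <Lex (c ∷ ys) → xs <Lex ys
∷-<Lex-∷⁻ (head< c<c) = ⊥-elim (<ₗ-asym c<c c<c)
∷-<Lex-∷⁻ (tail< p)   = p

<Lex-[♯]⇒a : ∀ {l xs} → (embed l ∷ xs) <Lex [ ♯ ] → embed l ≡ a
<Lex-[♯]⇒a {a'} _ = refl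
<Lex-[♯]⇒a {b'} (head< ())

[♯]-<Lex⇒b : ∀ {l xs} → [ ♯ ] <Lex (embed l ∷ xs) → embed l ≡ b
[♯]-<Lex⇒b {a'} (head< ())
[♯]-<Lex⇒b {b'} _ = refl

suffix-w♯-n : ∀ {n} (w : Vec AB n) → suffix (w♯ w) n ≡ [ ♯ ]
suffix-w♯-n []      = refl
suffix-w♯-n (_ ∷ w) = suffix-w♯-n w

suffix-w♯-< : ∀ {n} (w : Vec AB n) {j} (j<n : j < n) →
  suffix (w♯ w) j ≡ embed (lookup w (fromℕ< j<n)) ∷ suffix (w♯ w) (suc j)
suffix-w♯-< (_ ∷ w) {zero}  _   = refl
suffix-w♯-< (_ ∷ w) {suc j} j<n = suffix-w♯-< w (s<s⁻¹ j<n)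

toℕ-csuc-< : ∀ {n} {x : Fin (suc n)} → toℕ x < n → toℕ (csuc x) ≡ suc (toℕ x)
toℕ-csuc-< x<n = trans (toℕ-fromℕ< _) (m≤n⇒m%n≡m x<n)

toℕ-csuc-n : ∀ {n} {x : Fin (suc n)} → toℕ x ≡ n → toℕ (csuc x) ≡ 0
toℕ-csuc-n {n} x≡n = trans (toℕ-fromℕ< _) (trans (cong (λ k → suc k % suc n) x≡n) (n%n≡0 (suc n)))

csuc-injective : ∀ {n} {x y : Fin (suc n)} → csuc x ≡ csuc y → x ≡ y
csuc-injective {n} {x} {y} e
  with m≤n⇒m<n∨m≡n (toℕ≤pred[n] x) | m≤n⇒m<n∨m≡n (toℕ≤pred[n] y)
... | inj₁ x<n | inj₁ y<n =
  toℕ-injective (suc-injective (trans (sym (toℕ-csuc-< x<n)) (trans (cong toℕ e) (toℕ-csuc-< y<n))))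
... | inj₁ x<n | inj₂ y≡n =
  ⊥-elim (1+n≢0 (trans (sym (toℕ-csuc-< x<n)) (trans (cong toℕ e) (toℕ-csuc-n y≡n))))
... | inj₂ x≡n | inj₁ y<n =
  ⊥-elim (1+n≢0 (trans (sym (toℕ-csuc-< y<n)) (trans (cong toℕ (sym e)) (toℕ-csuc-n x≡n))))
... | inj₂ x≡n | inj₂ y≡n = toℕ-injective (trans x≡n (sym y≡n))

mod-toℕ : ∀ {n} (x : Fin (suc n)) → toℕ x mod suc n ≡ x
mod-toℕ x = toℕ-injective (trans (toℕ-fromℕ< _) (m≤n⇒m%n≡m (toℕ≤pred[n] x)))

toℕ≡⇒≡mod : ∀ {n k} {x : Fin (suc n)} → toℕ x ≡ k → x ≡ k mod suc n
toℕ≡⇒≡mod {n} {x = x} x≡k = trans (sym (mod-toℕ x)) (cong (_mod suc n) x≡k)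

inject₁-fromℕ< : ∀ {n} {x : Fin (suc n)} (x<n : toℕ x < n) → inject₁ (fromℕ< x<n) ≡ x
inject₁-fromℕ< x<n = toℕ-injective (trans (toℕ-inject₁ _) (toℕ-fromℕ< x<n))

inject₁<suc : ∀ {n} (i : Fin n) → toℕ (inject₁ i) < toℕ (fsuc i)
inject₁<suc i = ≤̄⇒inject₁< ≤-refl

consecutive-<⇒< : (g : ℕ → ℕ) {lo hi : ℕ} →
  (∀ {m} → lo ≤ m → suc m < hi → g m < g (suc m)) →
  ∀ {p q} → lo ≤ p → p < q → q < hi → g p < g q
consecutive-<⇒< g step {p} {suc q} lo≤p (s≤s p≤q) 1+q<hi with m≤n⇒m<n∨m≡n p≤q
... | inj₂ refl = step lo≤p 1+q<hi
... | inj₁ p<q  =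
  <-trans (consecutive-<⇒< g step lo≤p p<q (<-trans (n<1+n q) 1+q<hi))
          (step (≤-trans lo≤p (<⇒≤ p<q)) 1+q<hi)

module _ {n : ℕ} (π : Permutation′ (suc n)) where

  rank pos : Fin (suc n) → Fin (suc n)
  rank x = π ⟨$⟩ˡ x
  pos p  = π ⟨$⟩ʳ p

  ♯rank : Fin (suc n)
  ♯rank = rank (fromℕ n)

  DescentsAround♯ : Set
  DescentsAround♯ = ∀ (i : Fin n) → toℕ (Φ π (inject₁ i)) > toℕ (Φ π (fsuc i)) →
    (toℕ i + 1 ≡ toℕ ♯rank) ⊎ (toℕ i ≡ toℕ ♯rank)

  pos-Φ : ∀ p → pos (Φ π p) ≡ csuc (pos p)
  pos-Φ _ = inverseʳ π

  Φ-injective : ∀ {p q} → Φ π p ≡ Φ π q → p ≡ q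
  Φ-injective {p} {q} e = trans (sym (inverseˡ π)) (trans (cong rank pos≡) (inverseˡ π))
    where
    pos≡ : pos p ≡ pos q
    pos≡ = csuc-injective (trans (sym (pos-Φ p)) (trans (cong pos e) (pos-Φ q)))

  ♯rank⇒last : ∀ {p} → toℕ p ≡ toℕ ♯rank → toℕ (pos p) ≡ n
  ♯rank⇒last p≡♯ =
    trans (cong (toℕ ∘ pos) (toℕ-injective p≡♯)) (trans (cong toℕ (inverseʳ π)) (toℕ-fromℕ n))

  last⇒♯rank : ∀ {p} → toℕ (pos p) ≡ n → toℕ p ≡ toℕ ♯rank
  last⇒♯rank {p} p-last =
    cong toℕ (trans (sym (inverseˡ π)) (cong rank (toℕ-injective (trans p-last (sym (toℕ-fromℕ n))))))

  ≢♯rank⇒<n : ∀ {p} → toℕ p ≢ toℕ ♯rank → toℕ (pos p) < n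
  ≢♯rank⇒<n {p} p≢♯ = ≤∧≢⇒< (toℕ≤pred[n] (pos p)) (p≢♯ ∘ last⇒♯rank)

  toℕ-pos-Φ : ∀ {p} → toℕ (pos p) < n → toℕ (pos (Φ π p)) ≡ suc (toℕ (pos p))
  toℕ-pos-Φ {p} p<n = trans (cong toℕ (pos-Φ p)) (toℕ-csuc-< p<n)

  rankedSuffix : Vec AB n → Fin (suc n) → List Letter
  rankedSuffix w p = suffix (w♯ w) (toℕ (pos p))

  rankedSuffix-♯ : ∀ w {p} → toℕ p ≡ toℕ ♯rank → rankedSuffix w p ≡ [ ♯ ]
  rankedSuffix-♯ w p≡♯ = trans (cong (suffix (w♯ w)) (♯rank⇒last p≡♯)) (suffix-w♯-n w)

  rankedSuffix-∷ : ∀ w {p} (p<n : toℕ (pos p) < n) →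
    rankedSuffix w p ≡ embed (lookup w (fromℕ< p<n)) ∷ rankedSuffix w (Φ π p)
  rankedSuffix-∷ w p<n = trans (suffix-w♯-< w p<n)
    (cong (λ k → embed (lookup w (fromℕ< p<n)) ∷ suffix (w♯ w) k) (sym (toℕ-pos-Φ p<n)))

  record SplitAt♯ (w : Vec AB n) : Set where
    field
      below : ∀ {p} → toℕ p < toℕ ♯rank → rankedSuffix w p ≡ a ∷ rankedSuffix w (Φ π p)
      above : ∀ {p} → toℕ ♯rank < toℕ p → rankedSuffix w p ≡ b ∷ rankedSuffix w (Φ π p)

  module _ {w : Vec AB n} (SA : IsSuffixArray π (w♯ w)) where

    SA-reflects : ∀ {p q} → rankedSuffix w p <Lex rankedSuffix w q → toℕ p < toℕ q
    SA-reflects {p} {q} p<q with <-cmp (toℕ p) (toℕ q)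
    ... | tri< lt _ _ = lt
    ... | tri≈ _ eq _ rewrite toℕ-injective eq = ⊥-elim (<Lex-irrefl p<q)
    ... | tri> _ _ gt = ⊥-elim (<Lex-asym p<q (SA q p gt))

    SA⇒split : SplitAt♯ w
    SA⇒split = record { below = below ; above = above }
      where
      below : ∀ {p} → toℕ p < toℕ ♯rank → rankedSuffix w p ≡ a ∷ rankedSuffix w (Φ π p)
      below {p} p<♯ = trans (rankedSuffix-∷ w p<n) (cong (_∷ rankedSuffix w (Φ π p)) (<Lex-[♯]⇒a p<[♯]))
        where
        p<n = ≢♯rank⇒<n (<⇒≢ p<♯)
        p<[♯] = subst₂ _<Lex_ (rankedSuffix-∷ w p<n) (rankedSuffix-♯ w refl) (SA p ♯rank p<♯)
      above : ∀ {p} → toℕ ♯rank < toℕ p → rankedSuffix w p ≡ b ∷ rankedSuffix w (Φ π p)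
      above {p} ♯<p = trans (rankedSuffix-∷ w p<n) (cong (_∷ rankedSuffix w (Φ π p)) ([♯]-<Lex⇒b [♯]<p))
        where
        p<n = ≢♯rank⇒<n (>⇒≢ ♯<p)
        [♯]<p = subst₂ _<Lex_ (rankedSuffix-♯ w refl) (rankedSuffix-∷ w p<n) (SA ♯rank p ♯<p)

    open SplitAt♯ SA⇒split

    same-letter⇒Φ-< : ∀ {c p q} →
      rankedSuffix w p ≡ c ∷ rankedSuffix w (Φ π p) → rankedSuffix w q ≡ c ∷ rankedSuffix w (Φ π q) →
      toℕ p < toℕ q → toℕ (Φ π p) < toℕ (Φ π q)
    same-letter⇒Φ-< p≡ q≡ p<q = SA-reflects (∷-<Lex-∷⁻ (subst₂ _<Lex_ p≡ q≡ (SA _ _ p<q)))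

    SA⇒descentsAround♯ : DescentsAround♯
    SA⇒descentsAround♯ i desc with toℕ i ≟ toℕ ♯rank | suc (toℕ i) ≟ toℕ ♯rank
    ... | yes i≡♯ | _          = inj₂ i≡♯
    ... | no _    | yes 1+i≡♯ = inj₁ (trans (+-comm (toℕ i) 1) 1+i≡♯)
    ... | no i≢♯  | no 1+i≢♯ with <-cmp (toℕ i) (toℕ ♯rank)
    ...   | tri< i<♯ _ _ =
      ⊥-elim (<-asym desc (same-letter⇒Φ-< (below i′<♯) (below (≤∧≢⇒< i<♯ 1+i≢♯)) (inject₁<suc i)))
      where i′<♯ = subst (_< _) (sym (toℕ-inject₁ i)) i<♯
    ...   | tri≈ _ i≡♯ _ = ⊥-elim (i≢♯ i≡♯)
    ...   | tri> _ _ ♯<i =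
      ⊥-elim (<-asym desc (same-letter⇒Φ-< (above ♯<i′) (above (m<n⇒m<1+n ♯<i)) (inject₁<suc i)))
      where ♯<i′ = subst (_ <_) (sym (toℕ-inject₁ i)) ♯<i

  letterOfRank : Fin (suc n) → AB
  letterOfRank p with toℕ p <? toℕ ♯rank
  ... | yes _ = a'
  ... | no _  = b'

  letterOfRank-below : ∀ {p} → toℕ p < toℕ ♯rank → embed (letterOfRank p) ≡ a
  letterOfRank-below {p} p<♯ with toℕ p <? toℕ ♯rank
  ... | yes _  = refl
  ... | no p≮♯ = ⊥-elim (p≮♯ p<♯)

  letterOfRank-above : ∀ {p} → toℕ ♯rank < toℕ p → embed (letterOfRank p) ≡ b
  letterOfRank-above {p} ♯<p with toℕ p <? toℕ ♯rank
  ... | yes p<♯ = ⊥-elim (<-asym p<♯ ♯<p)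
  ... | no _    = refl

  canonicalWord : Vec AB n
  canonicalWord = tabulate (λ j → letterOfRank (rank (inject₁ j)))

  canonicalWord-letter : ∀ {p} (p<n : toℕ (pos p) < n) →
    lookup canonicalWord (fromℕ< p<n) ≡ letterOfRank p
  canonicalWord-letter {p} p<n = trans (lookup∘tabulate (letterOfRank ∘ rank ∘ inject₁) (fromℕ< p<n))
    (cong letterOfRank (trans (cong rank (inject₁-fromℕ< p<n)) (inverseˡ π)))

  canonicalWord-split : SplitAt♯ canonicalWord
  canonicalWord-split = record
    { below = λ p<♯ → starts-with (<⇒≢ p<♯) (letterOfRank-below p<♯)
    ; above = λ ♯<p → starts-with (>⇒≢ ♯<p) (letterOfRank-above ♯<p)
    }
    where
    starts-with : ∀ {p c} (p≢♯ : toℕ p ≢ toℕ ♯rank) → embed (letterOfRank p) ≡ c →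
      rankedSuffix canonicalWord p ≡ c ∷ rankedSuffix canonicalWord (Φ π p)
    starts-with p≢♯ letter≡c = trans (rankedSuffix-∷ canonicalWord p<n)
      (cong (_∷ _) (trans (cong embed (canonicalWord-letter p<n)) letter≡c))
      where p<n = ≢♯rank⇒<n p≢♯

  module _ (descents : DescentsAround♯) where

    Φ-ascent : ∀ (i : Fin n) → toℕ i ≢ toℕ ♯rank → suc (toℕ i) ≢ toℕ ♯rank →
      toℕ (Φ π (inject₁ i)) < toℕ (Φ π (fsuc i))
    Φ-ascent i i≢♯ 1+i≢♯ with <-cmp (toℕ (Φ π (inject₁ i))) (toℕ (Φ π (fsuc i)))
    ... | tri< lt _ _ = lt
    ... | tri≈ _ eq _ = ⊥-elim (<-irrefl (cong toℕ (Φ-injective (toℕ-injective eq))) (inject₁<suc i))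
    ... | tri> _ _ gt = ⊥-elim ([ 1+i≢♯ ∘ trans (+-comm 1 (toℕ i)) , i≢♯ ]′ (descents i gt))

    -- Φ(π) read on ℕ, so that its ascents can be chained by induction.
    Φℕ : ℕ → ℕ
    Φℕ m = toℕ (Φ π (m mod suc n))

    Φℕ-toℕ : ∀ p → Φℕ (toℕ p) ≡ toℕ (Φ π p)
    Φℕ-toℕ p = cong (toℕ ∘ Φ π) (mod-toℕ p)

    Φℕ-ascent : ∀ {m} → m < n → m ≢ toℕ ♯rank → suc m ≢ toℕ ♯rank → Φℕ m < Φℕ (suc m)
    Φℕ-ascent {m} m<n m≢♯ 1+m≢♯ =
      subst₂ (λ x y → toℕ (Φ π x) < toℕ (Φ π y))
        (toℕ≡⇒≡mod (trans (toℕ-inject₁ i) i≡m)) (toℕ≡⇒≡mod (cong suc i≡m))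
        (Φ-ascent i (m≢♯ ∘ trans (sym i≡m)) (1+m≢♯ ∘ trans (cong suc (sym i≡m))))
      where
      i = fromℕ< m<n
      i≡m = toℕ-fromℕ< m<n

    Φ-increasing-below : ∀ {p q} → toℕ p < toℕ q → toℕ q < toℕ ♯rank → toℕ (Φ π p) < toℕ (Φ π q)
    Φ-increasing-below {p} {q} p<q q<♯ =
      subst₂ _<_ (Φℕ-toℕ p) (Φℕ-toℕ q) (consecutive-<⇒< Φℕ step z≤n p<q q<♯)
      where
      step : ∀ {m} → 0 ≤ m → suc m < toℕ ♯rank → Φℕ m < Φℕ (suc m)
      step _ 1+m<♯ = Φℕ-ascent (≤-trans (<⇒≤ 1+m<♯) (toℕ≤pred[n] ♯rank))
        (<⇒≢ (<-trans (n<1+n _) 1+m<♯)) (<⇒≢ 1+m<♯)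

    Φ-increasing-above : ∀ {p q} → toℕ ♯rank < toℕ p → toℕ p < toℕ q → toℕ (Φ π p) < toℕ (Φ π q)
    Φ-increasing-above {p} {q} ♯<p p<q =
      subst₂ _<_ (Φℕ-toℕ p) (Φℕ-toℕ q) (consecutive-<⇒< Φℕ step ♯<p p<q (toℕ<n q))
      where
      step : ∀ {m} → toℕ ♯rank < m → suc m < suc n → Φℕ m < Φℕ (suc m)
      step ♯<m 1+m<1+n = Φℕ-ascent (s<s⁻¹ 1+m<1+n) (>⇒≢ ♯<m) (>⇒≢ (m<n⇒m<1+n ♯<m))

    split⇒SA : ∀ {w} → SplitAt♯ w → IsSuffixArray π (w♯ w)
    split⇒SA {w} split p q = sorted (n ∸ toℕ (pos p)) (m∸n+n≡m (toℕ≤pred[n] (pos p)))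
      where
      open SplitAt♯ split

      sorted : ∀ k {p q} → k + toℕ (pos p) ≡ n → toℕ p < toℕ q → rankedSuffix w p <Lex rankedSuffix w q
      sorted-∷ : ∀ k {c p q} → suc k + toℕ (pos p) ≡ n →
        rankedSuffix w p ≡ c ∷ rankedSuffix w (Φ π p) → rankedSuffix w q ≡ c ∷ rankedSuffix w (Φ π q) →
        toℕ (Φ π p) < toℕ (Φ π q) → rankedSuffix w p <Lex rankedSuffix w q

      sorted zero {p} p-last p<q =
        subst₂ _<Lex_ (sym (rankedSuffix-♯ w p≡♯)) (sym (above (subst (_< _) p≡♯ p<q))) (head< ♯<b)
        where p≡♯ = last⇒♯rank p-last
      sorted (suc k) {p} {q} e p<q with <-cmp (toℕ p) (toℕ ♯rank) | <-cmp (toℕ q) (toℕ ♯rank)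
      ... | tri< p<♯ _ _ | tri< q<♯ _ _ = sorted-∷ k e (below p<♯) (below q<♯) (Φ-increasing-below p<q q<♯)
      ... | tri< p<♯ _ _ | tri≈ _ q≡♯ _ =
        subst₂ _<Lex_ (sym (below p<♯)) (sym (rankedSuffix-♯ w q≡♯)) (head< a<♯)
      ... | tri< p<♯ _ _ | tri> _ _ ♯<q = subst₂ _<Lex_ (sym (below p<♯)) (sym (above ♯<q)) (head< a<b)
      ... | tri> _ _ ♯<p | tri> _ _ ♯<q = sorted-∷ k e (above ♯<p) (above ♯<q) (Φ-increasing-above ♯<p p<q)
      ... | tri> _ _ ♯<p | tri< q<♯ _ _ = ⊥-elim (<-asym p<q (<-trans q<♯ ♯<p))
      ... | tri> _ _ ♯<p | tri≈ _ q≡♯ _ = ⊥-elim (<-asym p<q (subst (_< _) (sym q≡♯) ♯<p))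
      ... | tri≈ _ p≡♯ _ | _ = ⊥-elim (m≢1+n+m n (trans (sym e) (cong (suc k +_) (♯rank⇒last p≡♯))))

      sorted-∷ k {p = p} e p≡ q≡ Φp<Φq = subst₂ _<Lex_ (sym p≡) (sym q≡) (tail< (sorted k e′ Φp<Φq))
        where
        p<n : toℕ (pos p) < n
        p<n = ≤-trans (s≤s (m≤n+m _ k)) (≤-reflexive e)
        e′ = trans (cong (k +_) (toℕ-pos-Φ p<n)) (trans (+-suc k _) e)

mainTheorem9 : ∀ (n : ℕ) (π : Permutation′ (suc n)) →
    (∃[ w ] IsSuffixArray π (w♯ {n} w))
    ⇔
    (∀ (i : Fin n) → toℕ (Φ π (inject₁ i)) > toℕ (Φ π (fsuc i)) →
    (toℕ i + 1 ≡ toℕ (π ⟨$⟩ˡ fromℕ n)) ⊎ (toℕ i ≡ toℕ (π ⟨$⟩ˡ fromℕ n)))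
mainTheorem9 n π = mk⇔ (λ (_ , SA) → SA⇒descentsAround♯ π SA)
                       (λ descents → canonicalWord π , split⇒SA π descents (canonicalWord-split π))
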